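{- Every infinite set $S\subseteq\omega$ with intrinsic lower density $0$ is immune; in particular, every infinite set with intrinsic density $0$ is immune.
   Context: For $X\subseteq\omega$, $\rho_n(X)=|X\cap[0,n)|/n$, $\underline{\rho}(X)=\liminf_n\rho_n(X)$. $S$ has intrinsic lower density $0$ if $\underline{\rho}(\pi(S))=0$ for every computable permutation $\pi$ of $\omega$; $S$ has intrinsic density $0$ if $\lim_n\rho_n(\pi(S))=0$ for every computable permutation $\pi$. A set is immune if it is infinite and has no infinite c.e. subset. -}

module Defs where

open import Data.Nat using (ℕ; zero; suc; _+_; _*_; _≤_; _<_)
open import Data.Fin using (Fin)
open import Data.Vec using (Vec; []; _∷_; lookup)
open import Data.Bool using (Bool; true; false)
open import Data.Product using (Σ; ∃; _×_; _,_)
open import Relation.Binary.PropositionalEquality using (_≡_)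
open import Relation.Nullary using (¬_)

data PR : ℕ → Set where
  zeroF : ∀ {n} → PR n
  succF : PR 1
  projF : ∀ {n} → Fin n → PR n
  compF : ∀ {m n} → PR m → Vec (PR n) m → PR n
  precF : ∀ {n} → PR n → PR (suc (suc n)) → PR (suc n)
  muF   : ∀ {n} → PR (suc n) → PR n

data Eval : ∀ {n} → PR n → Vec ℕ n → ℕ → Set
data EvalVec : ∀ {m n} → Vec (PR n) m → Vec ℕ n → Vec ℕ m → Set

data Eval where
  ev-zero : ∀ {n} {xs : Vec ℕ n} → Eval zeroF xs 0
  ev-succ : ∀ {x} → Eval succF (x ∷ []) (suc x)
  ev-proj : ∀ {n} {i : Fin n} {xs} → Eval (projF i) xs (lookup xs i)
  ev-comp : ∀ {m n} {f : PR m} {gs : Vec (PR n) m} {xs ys y} →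
            EvalVec gs xs ys → Eval f ys y → Eval (compF f gs) xs y
  ev-prec0 : ∀ {n} {g : PR n} {h xs y} →
             Eval g xs y → Eval (precF g h) (0 ∷ xs) y
  ev-precS : ∀ {n} {g : PR n} {h xs k r y} →
             Eval (precF g h) (k ∷ xs) r →
             Eval h (k ∷ r ∷ xs) y → Eval (precF g h) (suc k ∷ xs) y
  ev-mu : ∀ {n} {f : PR (suc n)} {xs y} →
          Eval f (y ∷ xs) 0 →
          (∀ z → z < y → Σ ℕ λ v → Eval f (z ∷ xs) (suc v)) →
          Eval (muF f) xs y

data EvalVec where
  evv-[] : ∀ {n} {xs : Vec ℕ n} → EvalVec [] xs []
  evv-∷  : ∀ {m n} {g : PR n} {gs : Vec (PR n) m} {xs y ys} →
           Eval g xs y → EvalVec gs xs ys → EvalVec (g ∷ gs) xs (y ∷ ys)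

Computable : (ℕ → ℕ) → Set
Computable f = Σ (PR 1) λ c → ∀ n → Eval c (n ∷ []) (f n)

record CompPerm : Set where
  field
    π       : ℕ → ℕ
    π⁻¹     : ℕ → ℕ
    π-comp  : Computable π
    left    : ∀ n → π⁻¹ (π n) ≡ n
    right   : ∀ n → π (π⁻¹ n) ≡ n

SubSet : Set
SubSet = ℕ → Bool

image : CompPerm → SubSet → SubSet
image p S m = S (CompPerm.π⁻¹ p m)

count : SubSet → ℕ → ℕ
count X zero = zero
count X (suc n) with X n
... | true  = suc (count X n)
... | false = count X n

Infinite : SubSet → Set
Infinite X = ∀ N → Σ ℕ λ n → N ≤ n × X n ≡ true

-- liminf ρ_n(X) = 0 : for every ε = 1/(k+1), infinitely many n with ρ_n(X) < ε
LowerDensityZero : SubSet → Set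
LowerDensityZero X = ∀ k N → Σ ℕ λ n → N ≤ n × suc k * count X n < n

-- lim ρ_n(X) = 0 : for every ε = 1/(k+1), eventually (n ≥ 1) ρ_n(X) < ε
DensityZero : SubSet → Set
DensityZero X = ∀ k → Σ ℕ λ N → ∀ n → N < n → suc k * count X n < n

IntrinsicLowerDensityZero : SubSet → Set
IntrinsicLowerDensityZero S = ∀ (p : CompPerm) → LowerDensityZero (image p S)

IntrinsicDensityZero : SubSet → Set
IntrinsicDensityZero S = ∀ (p : CompPerm) → DensityZero (image p S)

W : PR 1 → ℕ → Set
W c n = Σ ℕ λ v → Eval c (n ∷ []) v

Immune : SubSet → Set
Immune S = Infinite S ×
  (∀ (c : PR 1) → (∀ n → W c n → S n ≡ true) →
     ¬ (∀ N → Σ ℕ λ n → N ≤ n × W c n))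

-- Suppose an infinite c.e. set W_c is contained in S. Dovetailing the
-- computation of c gives a total computable selector F with a ≤ F a ∈ W_c.
-- Iterating it as g 0 = F 0, g (i + 1) = F (g i + 2) yields an increasing
-- sequence in W_c whose range P is computable (n ∈ P iff g i = n for some
-- i ≤ n), infinite, and co-infinite (no two consecutive numbers are in P).
-- Sending the k-th element of P to 2k and the k-th element of its
-- complement to 2k + 1 is a computable permutation p, and p(S) contains
-- every even number, so its lower density is at least 1/2, not 0.

module Submission where

open import Defs
open import Data.Bool using (Bool; true; false; not; if_then_else_)
open import Data.Nat
open import Data.Nat.Properties
open import Data.Fin using (Fin; zero; suc)
open import Data.Vec using (Vec; []; _∷_; lookup; head; tail)
open import Data.Product using (_×_; Σ; _,_; proj₁; proj₂)
open import Data.Sum using (inj₁; inj₂)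
open import Data.Empty using (⊥; ⊥-elim)
open import Relation.Binary.Definitions using (tri<; tri≈; tri>)
open import Relation.Binary.PropositionalEquality
open import Relation.Nullary using (¬_; yes; no; contradiction)

-- Every function below that must be shown computable is assembled from
-- these combinators, so its code is built along with it.

record Total (n : ℕ) : Set where
  constructor total
  field
    code : PR n
    fun  : Vec ℕ n → ℕ
    eval : ∀ xs → Eval code xs (fun xs)
open Total

run1 : Total 1 → ℕ → ℕ
run1 t n = fun t (n ∷ [])

codes : ∀ {m n} → Vec (Total n) m → Vec (PR n) m
codes []       = []
codes (g ∷ gs) = code g ∷ codes gs

funs : ∀ {m n} → Vec (Total n) m → Vec ℕ n → Vec ℕ m
funs []       xs = []
funs (g ∷ gs) xs = fun g xs ∷ funs gs xs

evals : ∀ {m n} (gs : Vec (Total n) m) xs → EvalVec (codes gs) xs (funs gs xs)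
evals []       xs = evv-[]
evals (g ∷ gs) xs = evv-∷ (eval g xs) (evals gs xs)

zeroT : ∀ {n} → Total n
zeroT = total zeroF (λ _ → 0) (λ _ → ev-zero)

succ1 : Total 1
succ1 = total succF (λ { (x ∷ []) → suc x }) (λ { (x ∷ []) → ev-succ })

projT : ∀ {n} → Fin n → Total n
projT i = total (projF i) (λ xs → lookup xs i) (λ _ → ev-proj)

compose : ∀ {m n} → Total m → Vec (Total n) m → Total n
compose f gs = total (compF (code f) (codes gs)) (λ xs → fun f (funs gs xs))
                     (λ xs → ev-comp (evals gs xs) (eval f _))

primRec : ∀ {n} → (Vec ℕ n → ℕ) → (Vec ℕ (suc (suc n)) → ℕ) → Vec ℕ (suc n) → ℕ
primRec g h (zero  ∷ xs) = g xs
primRec g h (suc k ∷ xs) = h (k ∷ primRec g h (k ∷ xs) ∷ xs)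

primRecT : ∀ {n} → Total n → Total (suc (suc n)) → Total (suc n)
primRecT g h = total (precF (code g) (code h)) (primRec (fun g) (fun h)) evaluates
  where
  evaluates : ∀ xs → Eval (precF (code g) (code h)) xs (primRec (fun g) (fun h) xs)
  evaluates (zero  ∷ xs) = ev-prec0 (eval g xs)
  evaluates (suc k ∷ xs) = ev-precS (evaluates (k ∷ xs)) (eval h _)

-- Replace the function of a total code by an extensionally equal one,
-- so that later proofs can refer to a readable definition.
withFun : ∀ {n} (t : Total n) (f : Vec ℕ n → ℕ) → (∀ xs → fun t xs ≡ f xs) → Total n
withFun t f eq = total (code t) f (λ xs → subst (Eval (code t) xs) (eq xs) (eval t xs))

app1 : ∀ {n} → Total 1 → Total n → Total n
app1 f a = compose f (a ∷ [])

app2 : ∀ {n} → Total 2 → Total n → Total n → Total n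
app2 f a b = compose f (a ∷ b ∷ [])

app3 : ∀ {n} → Total 3 → Total n → Total n → Total n → Total n
app3 f a b c = compose f (a ∷ b ∷ c ∷ [])

sucT : ∀ {n} → Total n → Total n
sucT = app1 succ1

oneT : ∀ {n} → Total n
oneT = sucT zeroT

projs : ∀ {m n} → (Fin m → Fin n) → Vec (Total n) m
projs {zero}  f = []
projs {suc m} f = projT (f zero) ∷ projs (λ i → f (suc i))

funs-projs : ∀ {m n} (f : Fin m → Fin n) (xs : Vec ℕ n) (ys : Vec ℕ m) →
             (∀ i → lookup xs (f i) ≡ lookup ys i) → funs (projs f) xs ≡ ys
funs-projs f xs []       h = refl
funs-projs f xs (y ∷ ys) h =
  cong₂ _∷_ (h zero) (funs-projs (λ i → f (suc i)) xs ys (λ i → h (suc i)))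

drop1 : ∀ {m} x (xs : Vec ℕ m) → funs (projs suc) (x ∷ xs) ≡ xs
drop1 x xs = funs-projs suc (x ∷ xs) xs (λ i → refl)

drop2 : ∀ {m} x y (xs : Vec ℕ m) → funs (projs (λ i → suc (suc i))) (x ∷ y ∷ xs) ≡ xs
drop2 x y xs = funs-projs _ (x ∷ y ∷ xs) xs (λ i → refl)

drop3 : ∀ {m} x y z (xs : Vec ℕ m) →
        funs (projs (λ i → suc (suc (suc i)))) (x ∷ y ∷ z ∷ xs) ≡ xs
drop3 x y z xs = funs-projs _ (x ∷ y ∷ z ∷ xs) xs (λ i → refl)

-- Basic arithmetic. Zero plays the role of "true" in tests.

ifZero : ℕ → ℕ → ℕ → ℕ
ifZero zero    b c = b
ifZero (suc _) b c = c

ifZero-nonzero : ∀ a b c → a ≢ 0 → ifZero a b c ≡ c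
ifZero-nonzero zero    b c a≢0 = ⊥-elim (a≢0 refl)
ifZero-nonzero (suc a) b c a≢0 = refl

ifZeroT : Total 3
ifZeroT = withFun (primRecT (projT zero) (projT (suc (suc (suc zero)))))
                  (λ { (a ∷ b ∷ c ∷ []) → ifZero a b c })
                  (λ { (zero ∷ b ∷ c ∷ []) → refl ; (suc a ∷ b ∷ c ∷ []) → refl })

predT : Total 1
predT = withFun (primRecT zeroT (projT zero)) (λ { (a ∷ []) → pred a })
                (λ { (zero ∷ []) → refl ; (suc a ∷ []) → refl })

monusT : Total 2
monusT = withFun (compose flipped (projT (suc zero) ∷ projT zero ∷ []))
                 (λ { (x ∷ y ∷ []) → x ∸ y })
                 (λ { (x ∷ y ∷ []) → flipped-fun y x })
  where
  flipped : Total 2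
  flipped = primRecT (projT zero) (app1 predT (projT (suc zero)))
  flipped-fun : ∀ y x → fun flipped (y ∷ x ∷ []) ≡ x ∸ y
  flipped-fun zero    x = refl
  flipped-fun (suc y) x = trans (cong pred (flipped-fun y x)) (pred[m∸n]≡m∸[1+n] x y)

addT : Total 2
addT = withFun raw (λ { (x ∷ y ∷ []) → x + y }) (λ { (x ∷ y ∷ []) → raw-fun x y })
  where
  raw : Total 2
  raw = primRecT (projT zero) (sucT (projT (suc zero)))
  raw-fun : ∀ k y → fun raw (k ∷ y ∷ []) ≡ k + y
  raw-fun zero    y = refl
  raw-fun (suc k) y = cong suc (raw-fun k y)

-- Bounded search: search f t ys is the least z < t with f (z ∷ ys) ≡ 0,
-- or t if there is none.

search : ∀ {m} → (Vec ℕ (suc m) → ℕ) → ℕ → Vec ℕ m → ℕ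
search f zero    ys = 0
search f (suc t) ys =
  ifZero (t ∸ search f t ys) (ifZero (f (t ∷ ys)) t (suc t)) (search f t ys)

searchT : ∀ {m} → Total (suc m) → Total (suc m)
searchT {m} f = withFun (primRecT zeroT step) searchFun agrees
  where
  step : Total (suc (suc m))
  step = app3 ifZeroT (app2 monusT (projT zero) (projT (suc zero)))
           (app3 ifZeroT (compose f (projT zero ∷ projs (λ i → suc (suc i))))
                         (projT zero) (sucT (projT zero)))
           (projT (suc zero))
  searchFun : Vec ℕ (suc m) → ℕ
  searchFun (t ∷ ys) = search (fun f) t ys
  agrees : ∀ xs → fun (primRecT zeroT step) xs ≡ searchFun xs
  agrees (zero  ∷ ys) = refl
  agrees (suc t ∷ ys) rewrite agrees (t ∷ ys) | drop2 t (search (fun f) t ys) ys = refl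

module _ {m : ℕ} (f : Vec ℕ (suc m) → ℕ) (ys : Vec ℕ m) where

  SearchSpec : ℕ → ℕ → Set
  SearchSpec t r = r ≤ t × (∀ z → z < r → f (z ∷ ys) ≢ 0) × (r < t → f (r ∷ ys) ≡ 0)

  search-suc-hit : ∀ t → search f t ys < t → search f (suc t) ys ≡ search f t ys
  search-suc-hit t r<t = ifZero-nonzero (t ∸ search f t ys) _ _ (m>n⇒m∸n≢0 r<t)

  search-suc-miss : ∀ t → search f t ys ≡ t →
                    search f (suc t) ys ≡ ifZero (f (t ∷ ys)) t (suc t)
  search-suc-miss t r≡t rewrite r≡t | n∸n≡0 t = refl

  search-spec : ∀ t → SearchSpec t (search f t ys)
  search-spec zero = z≤n , (λ z ()) , (λ ())
  search-spec (suc t) with search-spec t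
  ... | r≤t , below , found with m≤n⇒m<n∨m≡n r≤t
  ...   | inj₁ r<t rewrite search-suc-hit t r<t = m≤n⇒m≤1+n r≤t , below , (λ _ → found r<t)
  ...   | inj₂ r≡t rewrite search-suc-miss t r≡t with f (t ∷ ys) in ft
  ...     | zero  = n≤1+n t , subst (λ r → ∀ z → z < r → f (z ∷ ys) ≢ 0) r≡t below , (λ _ → ft)
  ...     | suc _ = ≤-refl , belowSuc , (λ t<t → ⊥-elim (n≮n _ t<t))
    where
    belowSuc : ∀ z → z < suc t → f (z ∷ ys) ≢ 0
    belowSuc z z<1+t with m≤n⇒m<n∨m≡n (≤-pred z<1+t)
    ... | inj₁ z<t  = below z (subst (z <_) (sym r≡t) z<t)
    ... | inj₂ refl = λ fz → 0≢1+n (trans (sym fz) ft)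

  search-minimal : ∀ t z → z < search f t ys → f (z ∷ ys) ≢ 0
  search-minimal t = proj₁ (proj₂ (search-spec t))

  search-found : ∀ t → search f t ys < t → f (search f t ys ∷ ys) ≡ 0
  search-found t = proj₂ (proj₂ (search-spec t))

  search-≤-zero : ∀ t z → f (z ∷ ys) ≡ 0 → search f t ys ≤ z
  search-≤-zero t z fz with z <? search f t ys
  ... | yes z<r = ⊥-elim (search-minimal t z z<r fz)
  ... | no  z≮r = ≮⇒≥ z≮r

  search-succeeds : ∀ t z → z < t → f (z ∷ ys) ≡ 0 → search f t ys < t
  search-succeeds t z z<t fz = ≤-<-trans (search-≤-zero t z fz) z<t

-- For every code c : PR n there is a TOTAL code
-- clocked c : Total (suc n) whose value at clock s and input xs is
-- suc v when c evaluates to v within the budget s, and 0 otherwise. The unbounded search of a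
-- μ-operator is cut off at the clock value.

-- 0 iff every entry is nonzero, i.e. every component has halted.
allHalted : ∀ {m} → Vec ℕ m → ℕ
allHalted []       = 0
allHalted (v ∷ vs) = ifZero v 1 (allHalted vs)

preds : ∀ {m} → Vec ℕ m → Vec ℕ m
preds []       = []
preds (v ∷ vs) = pred v ∷ preds vs

allHaltedT : ∀ {m n} → Vec (Total n) m → Total n
allHaltedT []       = zeroT
allHaltedT (g ∷ gs) = app3 ifZeroT g oneT (allHaltedT gs)

predsT : ∀ {m n} → Vec (Total n) m → Vec (Total n) m
predsT []       = []
predsT (g ∷ gs) = app1 predT g ∷ predsT gs

allHaltedT-fun : ∀ {m n} (gs : Vec (Total n) m) xs →
                 fun (allHaltedT gs) xs ≡ allHalted (funs gs xs)
allHaltedT-fun []       xs = refl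
allHaltedT-fun (g ∷ gs) xs = cong (ifZero (fun g xs) 1) (allHaltedT-fun gs xs)

predsT-fun : ∀ {m n} (gs : Vec (Total n) m) xs → funs (predsT gs) xs ≡ preds (funs gs xs)
predsT-fun []       xs = refl
predsT-fun (g ∷ gs) xs = cong (pred (fun g xs) ∷_) (predsT-fun gs xs)

module ClockedComp {m n : ℕ} (cf : Total (suc m)) (cgs : Vec (Total (suc n)) m) where
  compFun : Vec ℕ (suc n) → ℕ
  compFun (s ∷ xs) = ifZero (allHalted (funs cgs (s ∷ xs)))
                            (fun cf (s ∷ preds (funs cgs (s ∷ xs)))) 0

  compT : Total (suc n)
  compT = withFun raw compFun agrees
    where
    raw : Total (suc n)
    raw = app3 ifZeroT (allHaltedT cgs) (compose cf (projT zero ∷ predsT cgs)) zeroT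
    agrees : ∀ xs → fun raw xs ≡ compFun xs
    agrees (s ∷ xs) = cong₂ (λ a b → ifZero a (fun cf (s ∷ b)) 0)
                            (allHaltedT-fun cgs (s ∷ xs)) (predsT-fun cgs (s ∷ xs))

module ClockedRec {n : ℕ} (cg : Total (suc n)) (ch : Total (suc (suc (suc n)))) where
  recFun : ℕ → Vec ℕ n → ℕ → ℕ
  recFun s xs zero    = fun cg (s ∷ xs)
  recFun s xs (suc k) = ifZero (recFun s xs k) 0 (fun ch (s ∷ k ∷ pred (recFun s xs k) ∷ xs))

  recFunV : Vec ℕ (suc (suc n)) → ℕ
  recFunV (s ∷ k ∷ xs) = recFun s xs k

  recT : Total (suc (suc n))
  recT = withFun raw recFunV agrees
    where
    step : Total (suc (suc (suc n)))
    step = app3 ifZeroT (projT (suc zero)) zeroT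
             (compose ch (projT (suc (suc zero)) ∷ projT zero ∷ app1 predT (projT (suc zero))
                          ∷ projs (λ i → suc (suc (suc i)))))
    raw : Total (suc (suc n))
    raw = compose (primRecT cg step) (projT (suc zero) ∷ projT zero ∷ projs (λ i → suc (suc i)))
    iterate : ∀ s xs k → primRec (fun cg) (fun step) (k ∷ s ∷ xs) ≡ recFun s xs k
    iterate s xs zero    = refl
    iterate s xs (suc k) rewrite iterate s xs k | drop3 k (recFun s xs k) s xs = refl
    agrees : ∀ xs → fun raw xs ≡ recFunV xs
    agrees (s ∷ k ∷ xs) rewrite drop2 s k xs = iterate s xs k

-- μ-operator: search below the clock for the least z at which f has
-- not halted or has halted with value 0, then check which case it is.
module ClockedMu {n : ℕ} (cf : Total (suc (suc n))) where
  stopFun : Vec ℕ (suc (suc n)) → ℕ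
  stopFun (z ∷ s ∷ xs) = pred (fun cf (s ∷ z ∷ xs))

  stopT : Total (suc (suc n))
  stopT = withFun raw stopFun agrees
    where
    raw : Total (suc (suc n))
    raw = app1 predT (compose cf (projT (suc zero) ∷ projT zero ∷ projs (λ i → suc (suc i))))
    agrees : ∀ xs → fun raw xs ≡ stopFun xs
    agrees (z ∷ s ∷ xs) rewrite drop2 z s xs = refl

  candidate : ℕ → Vec ℕ n → ℕ
  candidate s xs = search stopFun s (s ∷ xs)

  candidateT : Total (suc n)
  candidateT = withFun raw (λ xs → candidate (head xs) (tail xs)) agrees
    where
    raw : Total (suc n)
    raw = compose (searchT stopT) (projT zero ∷ projT zero ∷ projs suc)
    agrees : ∀ xs → fun raw xs ≡ candidate (head xs) (tail xs)
    agrees (s ∷ xs) rewrite drop1 s xs = refl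

  muFun : ℕ → Vec ℕ n → ℕ
  muFun s xs = ifZero (s ∸ candidate s xs) 0
                 (ifZero (fun cf (s ∷ candidate s xs ∷ xs)) 0 (suc (candidate s xs)))

  muT : Total (suc n)
  muT = withFun raw (λ xs → muFun (head xs) (tail xs)) agrees
    where
    raw : Total (suc n)
    raw = app3 ifZeroT (app2 monusT (projT zero) candidateT) zeroT
            (app3 ifZeroT (compose cf (projT zero ∷ candidateT ∷ projs suc)) zeroT (sucT candidateT))
    agrees : ∀ xs → fun raw xs ≡ muFun (head xs) (tail xs)
    agrees (s ∷ xs) rewrite drop1 s xs = refl

clocked : ∀ {n} → PR n → Total (suc n)
clockedVec : ∀ {m n} → Vec (PR n) m → Vec (Total (suc n)) m
clocked zeroF        = oneT
clocked succF        = sucT (sucT (projT (suc zero)))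
clocked (projF i)    = sucT (projT (suc i))
clocked (compF f gs) = ClockedComp.compT (clocked f) (clockedVec gs)
clocked (precF g h)  = ClockedRec.recT (clocked g) (clocked h)
clocked (muF f)      = ClockedMu.muT (clocked f)
clockedVec []       = []
clockedVec (g ∷ gs) = clocked g ∷ clockedVec gs

runFor : ∀ {n} → PR n → ℕ → Vec ℕ n → ℕ
runFor c s xs = fun (clocked c) (s ∷ xs)

Sound : ∀ {n} → PR n → Set
Sound c = ∀ s xs v → runFor c s xs ≡ suc v → Eval c xs v

pred≢0 : ∀ x → pred x ≢ 0 → Σ ℕ λ u → x ≡ suc (suc u)
pred≢0 zero          p≢0 = ⊥-elim (p≢0 refl)
pred≢0 (suc zero)    p≢0 = ⊥-elim (p≢0 refl)
pred≢0 (suc (suc u)) p≢0 = u , refl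

module _ {n : ℕ} (f : PR (suc n)) (sound-f : Sound f) where
  open ClockedMu (clocked f)

  soundMu : Sound (muF f)
  soundMu s xs v halts with s ∸ candidate s xs in gap | runFor f s (candidate s xs ∷ xs) in fy
  ... | zero  | _     = ⊥-elim (0≢1+n halts)
  ... | suc _ | zero  = ⊥-elim (0≢1+n halts)
  ... | suc _ | suc w with halts
  ...   | refl = ev-mu (sound-f s (y ∷ xs) 0 (trans fy (cong suc w≡0))) below
    where
    y = candidate s xs
    y<s : y < s
    y<s = m∸n≢0⇒n<m (λ gap≡0 → 0≢1+n (trans (sym gap≡0) gap))
    w≡0 : w ≡ 0
    w≡0 = trans (sym (cong pred fy)) (search-found stopFun (s ∷ xs) s y<s)
    below : ∀ z → z < y → Σ ℕ λ u → Eval f (z ∷ xs) (suc u)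
    below z z<y with pred≢0 (runFor f s (z ∷ xs)) (search-minimal stopFun (s ∷ xs) s z z<y)
    ... | u , fz = u , sound-f s (z ∷ xs) (suc u) fz

sound : ∀ {n} (c : PR n) → Sound c
soundVec : ∀ {m n} (gs : Vec (PR n) m) s xs → allHalted (funs (clockedVec gs) (s ∷ xs)) ≡ 0 →
           EvalVec gs xs (preds (funs (clockedVec gs) (s ∷ xs)))
soundRec : ∀ {n} (g : PR n) h s xs k v →
           ClockedRec.recFun (clocked g) (clocked h) s xs k ≡ suc v → Eval (precF g h) (k ∷ xs) v

sound zeroF s xs .0 refl = ev-zero
sound succF s (x ∷ []) .(suc x) refl = ev-succ
sound (projF i) s xs .(lookup xs i) refl = ev-proj
sound (compF f gs) s xs v halts with allHalted (funs (clockedVec gs) (s ∷ xs)) in all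
... | zero  = ev-comp (soundVec gs s xs all) (sound f s _ v halts)
... | suc _ = ⊥-elim (0≢1+n halts)
sound (precF g h) s (k ∷ xs) v halts = soundRec g h s xs k v halts
sound (muF f) = soundMu f (sound f)

soundVec []       s xs all = evv-[]
soundVec (g ∷ gs) s xs all with runFor g s xs in gx
... | zero  = ⊥-elim (0≢1+n (sym all))
... | suc w = evv-∷ (sound g s xs w gx) (soundVec gs s xs all)

soundRec g h s xs zero    v halts = ev-prec0 (sound g s xs v halts)
soundRec g h s xs (suc k) v halts with ClockedRec.recFun (clocked g) (clocked h) s xs k in rk
... | zero  = ⊥-elim (0≢1+n halts)
... | suc r = ev-precS (soundRec g h s xs k r rk) (sound h s (k ∷ r ∷ xs) v halts)

Eventually : (ℕ → Set) → Set
Eventually Q = Σ ℕ λ s₀ → ∀ s → s₀ ≤ s → Q s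

eventually-≥ : ∀ k → Eventually (k ≤_)
eventually-≥ k = k , λ s k≤s → k≤s

eventually-both : ∀ {P Q : ℕ → Set} → Eventually P → Eventually Q → Eventually (λ s → P s × Q s)
eventually-both (s₁ , p) (s₂ , q) =
  s₁ ⊔ s₂ , λ s le → p s (≤-trans (m≤m⊔n s₁ s₂) le) , q s (≤-trans (m≤n⊔m s₁ s₂) le)

eventually-map : ∀ {P Q : ℕ → Set} → (∀ {s} → P s → Q s) → Eventually P → Eventually Q
eventually-map f (s₀ , p) = s₀ , λ s le → f (p s le)

eventually-below : ∀ (Q : ℕ → ℕ → Set) y →
                   (∀ z → z < y → Eventually (Q z)) → Eventually (λ s → ∀ z → z < y → Q z s)
eventually-below Q zero    ev = 0 , λ _ _ z ()
eventually-below Q (suc y) ev =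
  eventually-map combine
    (eventually-both (eventually-below Q y (λ z z<y → ev z (m≤n⇒m≤1+n z<y))) (ev y ≤-refl))
  where
  combine : ∀ {s} → (∀ z → z < y → Q z s) × Q y s → ∀ z → z < suc y → Q z s
  combine (below , at) z z<1+y with m≤n⇒m<n∨m≡n (≤-pred z<1+y)
  ... | inj₁ z<y  = below z z<y
  ... | inj₂ refl = at

sucs : ∀ {m} → Vec ℕ m → Vec ℕ m
sucs []       = []
sucs (v ∷ vs) = suc v ∷ sucs vs

allHalted-sucs : ∀ {m} (ys : Vec ℕ m) → allHalted (sucs ys) ≡ 0
allHalted-sucs []       = refl
allHalted-sucs (y ∷ ys) = allHalted-sucs ys

preds-sucs : ∀ {m} (ys : Vec ℕ m) → preds (sucs ys) ≡ ys
preds-sucs []       = refl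
preds-sucs (y ∷ ys) = cong (y ∷_) (preds-sucs ys)

muAt : ∀ {n} (f : PR (suc n)) s xs y → y < s → runFor f s (y ∷ xs) ≡ 1 →
       (∀ z → z < y → Σ ℕ λ u → runFor f s (z ∷ xs) ≡ suc (suc u)) →
       runFor (muF f) s xs ≡ suc y
muAt f s xs y y<s fy below =
  begin
    muFun s xs
  ≡⟨ cong (λ t → ifZero (s ∸ t) 0 (ifZero (runFor f s (t ∷ xs)) 0 (suc t))) found-y ⟩
    ifZero (s ∸ y) 0 (ifZero (runFor f s (y ∷ xs)) 0 (suc y))
  ≡⟨ ifZero-nonzero (s ∸ y) _ _ (m>n⇒m∸n≢0 y<s) ⟩
    ifZero (runFor f s (y ∷ xs)) 0 (suc y)
  ≡⟨ cong (λ a → ifZero a 0 (suc y)) fy ⟩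
    suc y
  ∎
  where
  open ClockedMu (clocked f)
  open ≡-Reasoning
  stop-y : stopFun (y ∷ s ∷ xs) ≡ 0
  stop-y = cong pred fy
  candidate≤y : candidate s xs ≤ y
  candidate≤y = search-≤-zero stopFun (s ∷ xs) s y stop-y
  y≤candidate : y ≤ candidate s xs
  y≤candidate with y ≤? candidate s xs
  ... | yes y≤c = y≤c
  ... | no  y≰c with below (candidate s xs) (≰⇒> y≰c)
  ...   | u , fz = ⊥-elim (0≢1+n (trans (sym (search-found stopFun (s ∷ xs) s
                                               (≤-<-trans candidate≤y y<s))) (cong pred fz)))
  found-y : candidate s xs ≡ y
  found-y = ≤-antisym candidate≤y y≤candidate

complete : ∀ {n} {c : PR n} {xs v} → Eval c xs v → Eventually (λ s → runFor c s xs ≡ suc v)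
completeVec : ∀ {m n} {gs : Vec (PR n) m} {xs ys} → EvalVec gs xs ys →
              Eventually (λ s → funs (clockedVec gs) (s ∷ xs) ≡ sucs ys)

complete ev-zero = 0 , λ _ _ → refl
complete ev-succ = 0 , λ _ _ → refl
complete ev-proj = 0 , λ _ _ → refl
complete {c = compF f gs} {xs} {v} (ev-comp {ys = ys} dgs df) =
  eventually-map halts (eventually-both (completeVec dgs) (complete df))
  where
  halts : ∀ {s} → funs (clockedVec gs) (s ∷ xs) ≡ sucs ys × runFor f s ys ≡ suc v →
          runFor (compF f gs) s xs ≡ suc v
  halts {s} (inner , outer) rewrite inner | allHalted-sucs ys | preds-sucs ys = outer
complete (ev-prec0 dg) = complete dg
complete {c = precF g h} {suc k ∷ xs} {v} (ev-precS {r = r} drec dh) =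
  eventually-map halts (eventually-both (complete drec) (complete dh))
  where
  halts : ∀ {s} → runFor (precF g h) s (k ∷ xs) ≡ suc r × runFor h s (k ∷ r ∷ xs) ≡ suc v →
          runFor (precF g h) s (suc k ∷ xs) ≡ suc v
  halts (previous , step) rewrite previous = step
complete {c = muF f} {xs} {y} (ev-mu df below) =
  eventually-map (λ { (y<s , fy , fbelow) → muAt f _ xs y y<s fy fbelow })
    (eventually-both (eventually-≥ (suc y))
      (eventually-both (complete df) (eventually-below _ y completeBelow)))
  where
  completeBelow : ∀ z → z < y → Eventually (λ s → Σ ℕ λ u → runFor f s (z ∷ xs) ≡ suc (suc u))
  completeBelow z z<y with below z z<y
  ... | u , dz = eventually-map (u ,_) (complete dz)

completeVec evv-[] = 0 , λ _ _ → refl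
completeVec (evv-∷ dg dgs) =
  eventually-map (λ { (head , tail) → cong₂ _∷_ head tail })
    (eventually-both (complete dg) (completeVec dgs))

minimize : ∀ {n} (f : Total (suc n)) → (∀ xs → Σ ℕ λ t → fun f (t ∷ xs) ≡ 0) → Total n
minimize {n} f hasZero = total (muF (code f)) least evaluates
  where
  bound : Vec ℕ n → ℕ
  bound xs = suc (proj₁ (hasZero xs))
  least : Vec ℕ n → ℕ
  least xs = search (fun f) (bound xs) xs
  least<bound : ∀ xs → least xs < bound xs
  least<bound xs = search-succeeds (fun f) xs (bound xs) _ (n<1+n _) (proj₂ (hasZero xs))
  evaluates : ∀ xs → Eval (muF (code f)) xs (least xs)
  evaluates xs = ev-mu (subst (Eval (code f) (least xs ∷ xs))
                              (search-found (fun f) xs (bound xs) (least<bound xs))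
                              (eval f (least xs ∷ xs)))
                       positiveBelow
    where
    positiveBelow : ∀ z → z < least xs → Σ ℕ λ v → Eval (code f) (z ∷ xs) (suc v)
    positiveBelow z z<least with fun f (z ∷ xs) in fz
    ... | zero  = ⊥-elim (search-minimal (fun f) xs (bound xs) z z<least fz)
    ... | suc v = v , subst (Eval (code f) (z ∷ xs)) fz (eval f (z ∷ xs))

minimize-zero : ∀ {n} (f : Total (suc n)) hasZero xs → fun f (fun (minimize f hasZero) xs ∷ xs) ≡ 0
minimize-zero f hasZero xs =
  search-found (fun f) xs (suc (proj₁ (hasZero xs)))
    (search-succeeds (fun f) xs _ _ (n<1+n _) (proj₂ (hasZero xs)))

false≢true : false ≢ true
false≢true ()

bit : Bool → ℕ
bit true  = 1
bit false = 0

module _ (X : SubSet) where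

  count-suc : ∀ n → count X (suc n) ≡ count X n + bit (X n)
  count-suc n with X n
  ... | true  = +-comm 1 (count X n)
  ... | false = sym (+-identityʳ _)

  count-true : ∀ n → X n ≡ true → count X (suc n) ≡ suc (count X n)
  count-true n Xn with X n
  count-true n refl | true = refl

  count-false : ∀ n → X n ≡ false → count X (suc n) ≡ count X n
  count-false n Xn with X n
  count-false n refl | false = refl

  count-≤ : ∀ n → count X n ≤ n
  count-≤ zero = z≤n
  count-≤ (suc n) with X n
  ... | true  = s≤s (count-≤ n)
  ... | false = m≤n⇒m≤1+n (count-≤ n)

  count-mono : ∀ {a b} → a ≤ b → count X a ≤ count X b
  count-mono {b = zero}  z≤n = ≤-refl
  count-mono {a} {suc b} a≤1+b with m≤n⇒m<n∨m≡n a≤1+b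
  ... | inj₂ refl = ≤-refl
  ... | inj₁ a<1+b = ≤-trans (count-mono (≤-pred a<1+b))
                             (subst (count X b ≤_) (sym (count-suc b)) (m≤m+n _ _))

  count-strict : ∀ {a b} → a < b → X a ≡ true → count X a < count X b
  count-strict {a} a<b Xa = subst (_≤ _) (count-true a Xa) (count-mono a<b)

  count-injective : ∀ {a b} → X a ≡ true → X b ≡ true → count X a ≡ count X b → a ≡ b
  count-injective {a} {b} Xa Xb eq with <-cmp a b
  ... | tri< a<b _ _ = ⊥-elim (<⇒≢ (count-strict a<b Xa) eq)
  ... | tri≈ _ a≡b _ = a≡b
  ... | tri> _ _ b<a = ⊥-elim (<⇒≢ (count-strict b<a Xb) (sym eq))

  count-complement : ∀ n → count (λ m → not (X m)) n ≡ n ∸ count X n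
  count-complement zero = refl
  count-complement (suc n) with X n
  ... | true  = count-complement n
  ... | false = trans (cong suc (count-complement n)) (sym (+-∸-assoc 1 (count-≤ n)))

module Enumerate (Q : SubSet) (infinite : Infinite Q) where

  -- an element of Q with as many smaller elements in Q as a has; this is
  -- the least element of Q that is ≥ a
  Next : ℕ → Set
  Next a = Σ ℕ λ n → Q n ≡ true × count Q n ≡ count Q a

  scan : ∀ k a → Q (k + a) ≡ true → Next a
  scan k a Qk+a with Q a in Qa
  ... | true = a , Qa , refl
  scan zero    a Qa' | false = ⊥-elim (false≢true (trans (sym Qa) Qa'))
  scan (suc k) a Qk+a | false with scan k (suc a) (subst (λ x → Q x ≡ true) (sym (+-suc k a)) Qk+a)
  ... | n , Qn , cn = n , Qn , trans cn (count-false Q a Qa)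

  next : ∀ a → Next a
  next a with infinite a
  ... | n , a≤n , Qn = scan (n ∸ a) a (subst (λ x → Q x ≡ true) (sym (m∸n+n≡m a≤n)) Qn)

  start : ℕ → ℕ
  nth : ℕ → ℕ
  start zero    = 0
  start (suc i) = suc (nth i)
  nth i = proj₁ (next (start i))

  nth-in : ∀ i → Q (nth i) ≡ true
  nth-in i = proj₁ (proj₂ (next (start i)))

  count-nth : ∀ i → count Q (nth i) ≡ i
  count-nth zero    = proj₂ (proj₂ (next 0))
  count-nth (suc i) = begin
    count Q (nth (suc i))   ≡⟨ proj₂ (proj₂ (next (suc (nth i)))) ⟩
    count Q (suc (nth i))   ≡⟨ count-true Q (nth i) (nth-in i) ⟩
    suc (count Q (nth i))   ≡⟨ cong suc (count-nth i) ⟩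
    suc i                   ∎
    where open ≡-Reasoning

  nth-count : ∀ n → Q n ≡ true → nth (count Q n) ≡ n
  nth-count n Qn = count-injective Q (nth-in (count Q n)) Qn (count-nth (count Q n))

data Halves : ℕ → Set where
  even : ∀ i → Halves (i + i)
  odd  : ∀ i → Halves (suc (i + i))

halves : ∀ m → Halves m
halves zero = even 0
halves (suc m) with halves m
... | even i = odd i
... | odd  i = subst Halves (+-suc (suc i) i) (even (suc i))

interleave : (ℕ → ℕ) → (ℕ → ℕ) → ℕ → ℕ
interleave f g zero          = f 0
interleave f g (suc zero)    = g 0
interleave f g (suc (suc m)) = interleave (λ i → f (suc i)) (λ i → g (suc i)) m

interleave-even : ∀ f g i → interleave f g (i + i) ≡ f i
interleave-even f g zero    = refl
interleave-even f g (suc i) rewrite +-suc i i = interleave-even (λ i → f (suc i)) (λ i → g (suc i)) i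

interleave-odd : ∀ f g i → interleave f g (suc (i + i)) ≡ g i
interleave-odd f g zero    = refl
interleave-odd f g (suc i) rewrite +-suc i i = interleave-odd (λ i → f (suc i)) (λ i → g (suc i)) i

-- A set containing every even number does not have lower density 0,
-- since it has at least i elements below i + i.

count-evens : ∀ (X : SubSet) → (∀ i → X (i + i) ≡ true) → ∀ i → i ≤ count X (i + i)
count-evens X evens zero    = z≤n
count-evens X evens (suc i) rewrite +-suc i i =
  ≤-trans (subst (suc i ≤_) (sym (count-true X (i + i) (evens i))) (s≤s (count-evens X evens i)))
          (count-mono X (n≤1+n _))

triple<double⇒0 : ∀ i → 3 * i < suc (i + i) → i ≡ 0
triple<double⇒0 i 3i<1+2i =
  trans (sym (+-identityʳ i)) (n≤0⇒n≡0 (+-cancelˡ-≤ i (i + 0) 0 2i≤i))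
  where
  2i≤i : i + (i + 0) ≤ i + 0
  2i≤i = subst (i + (i + 0) ≤_) (sym (+-identityʳ i)) (+-cancelˡ-≤ i (i + (i + 0)) i (≤-pred 3i<1+2i))

evens-not-sparse : ∀ (X : SubSet) → (∀ i → X (i + i) ≡ true) → ¬ LowerDensityZero X
evens-not-sparse X evens ldz with ldz 2 2
... | n , 2≤n , 3c<n = impossible (halves n) 2≤n 3c<n
  where
  -- ρ_n(X) < 1/3 for some n ≥ 2; but count X n ≥ i while n ≤ 2i + 1,
  -- so 3 · count X n < n forces i = 0
  impossible : ∀ {n} → Halves n → 2 ≤ n → 3 * count X n < n → ⊥
  impossible (even i) 2≤n 3c<n with triple<double⇒0 i (≤-<-trans (*-monoʳ-≤ 3 (count-evens X evens i))
                                                  (m≤n⇒m≤1+n 3c<n))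
  ... | refl = contradiction 2≤n λ ()
  impossible (odd i) 2≤n 3c<n with triple<double⇒0 i (≤-<-trans (*-monoʳ-≤ 3
                                  (≤-trans (count-evens X evens i) (count-mono X (n≤1+n _)))) 3c<n)
  ... | refl = contradiction 2≤n λ { (s≤s ()) }

density→lowerDensity : ∀ X → DensityZero X → LowerDensityZero X
density→lowerDensity X dz k N with dz k
... | M , sparse = suc (N + M) , m≤n⇒m≤1+n (m≤m+n N M) , sparse _ (s≤s (m≤n+m M N))

ComputableSet : SubSet → Set
ComputableSet P = Σ (Total 1) λ χ → ∀ n → run1 χ n ≡ bit (P n)

isZero : ℕ → Bool
isZero zero    = true
isZero (suc _) = false

isZero-true : ∀ x → isZero x ≡ true → x ≡ 0
isZero-true zero refl = refl

bit-isZero : ∀ x → bit (isZero x) ≡ 1 ∸ x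
bit-isZero zero    = refl
bit-isZero (suc x) = sym (0∸n≡0 x)

1∸x≡0 : ∀ x → 1 ∸ x ≡ 0 → Σ ℕ λ w → x ≡ suc w
1∸x≡0 (suc w) _ = w , refl

-- An infinite c.e. set W_c has a computable selector: a total computable
-- F with a ≤ F a ∈ W_c. F a is found by dovetailing: the first clock t
-- at which some a + d with d ≤ t is seen to halt within t steps.

module Selector (c : PR 1) (infinite : ∀ N → Σ ℕ λ n → N ≤ n × W c n) where

  -- (d , t , a) ↦ 0 iff c halts on a + d within clock t
  haltsT : Total 3
  haltsT = app2 monusT oneT
             (compose (clocked c) (projT (suc zero) ∷ app2 addT (projT (suc (suc zero))) (projT zero) ∷ []))

  -- least d ≤ t for which a + d halts within clock t, or suc t if none
  firstHalt : ℕ → ℕ → ℕ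
  firstHalt t a = search (fun haltsT) (suc t) (t ∷ a ∷ [])

  firstHaltT : Total 2
  firstHaltT = compose (searchT haltsT) (sucT (projT zero) ∷ projT zero ∷ projT (suc zero) ∷ [])

  -- (t , a) ↦ 0 iff the search at clock t succeeds
  successT : Total 2
  successT = app2 monusT firstHaltT (projT zero)

  succeeds-eventually : ∀ xs → Σ ℕ λ t → fun successT (t ∷ xs) ≡ 0
  succeeds-eventually (a ∷ []) with infinite a
  ... | x , a≤x , v , halts with complete halts
  ...   | s₀ , confirmed = s₀ + d , m≤n⇒m∸n≡0 (≤-trans found≤d (m≤n+m d s₀))
    where
    d = x ∸ a
    halts-d : fun haltsT (d ∷ s₀ + d ∷ a ∷ []) ≡ 0
    halts-d rewrite m+[n∸m]≡n a≤x | confirmed (s₀ + d) (m≤m+n s₀ d) = 0∸n≡0 v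
    found≤d : firstHalt (s₀ + d) a ≤ d
    found≤d = search-≤-zero (fun haltsT) (s₀ + d ∷ a ∷ []) (suc (s₀ + d)) d halts-d

  timeT : Total 1
  timeT = minimize successT succeeds-eventually

  time : ℕ → ℕ
  time = run1 timeT

  found-in-time : ∀ a → firstHalt (time a) a < suc (time a)
  found-in-time a = s≤s (m∸n≡0⇒m≤n (minimize-zero successT succeeds-eventually (a ∷ [])))

  selectorT : Total 1
  selectorT = app2 addT (projT zero) (compose firstHaltT (timeT ∷ projT zero ∷ []))

  selector-above : ∀ a → a ≤ run1 selectorT a
  selector-above a = m≤m+n a _

  selector-in : ∀ a → W c (run1 selectorT a)
  selector-in a with 1∸x≡0 _ (search-found (fun haltsT) (time a ∷ a ∷ []) (suc (time a)) (found-in-time a))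
  ... | w , halts = w , sound c (time a) _ w halts

distance : ℕ → ℕ → ℕ
distance x y = (x ∸ y) + (y ∸ x)

distance≡0 : ∀ x y → distance x y ≡ 0 → x ≡ y
distance≡0 x y d≡0 = ≤-antisym (m∸n≡0⇒m≤n (m+n≡0⇒m≡0 _ d≡0)) (m∸n≡0⇒m≤n (m+n≡0⇒n≡0 (x ∸ y) d≡0))

distance-self : ∀ x → distance x x ≡ 0
distance-self x rewrite n∸n≡0 x = refl

-- From a selector F for R (a ≤ F a ∈ R) build g 0 = F 0 and
-- g (i + 1) = F (g i + 2). Its range is a computable subset of R which
-- is infinite, and co-infinite because consecutive values differ by ≥ 2.

module SparseRange (R : ℕ → Set) (F : Total 1)
                   (F-above : ∀ a → a ≤ run1 F a) (F-in : ∀ a → R (run1 F a)) where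

  gT : Total 1
  gT = primRecT (app1 F zeroT) (app1 F (sucT (sucT (projT (suc zero)))))

  g : ℕ → ℕ
  g = run1 gT

  g-in : ∀ i → R (g i)
  g-in zero    = F-in 0
  g-in (suc i) = F-in (suc (suc (g i)))

  g-step : ∀ i → suc (suc (g i)) ≤ g (suc i)
  g-step i = F-above (suc (suc (g i)))

  g-gap : ∀ {i j} → i < j → suc (suc (g i)) ≤ g j
  g-gap {i} {suc j} i<1+j with m≤n⇒m<n∨m≡n (≤-pred i<1+j)
  ... | inj₂ refl = g-step i
  ... | inj₁ i<j  = ≤-trans (g-gap i<j) (≤-trans (m≤n+m (g j) 2) (g-step j))

  g-≥ : ∀ i → i ≤ g i
  g-≥ zero    = z≤n
  g-≥ (suc i) = ≤-trans (s≤s (m≤n⇒m≤1+n (g-≥ i))) (g-step i)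

  distanceT : Total 2
  distanceT = app2 addT (app2 monusT (app1 gT (projT zero)) (projT (suc zero)))
                        (app2 monusT (projT (suc zero)) (app1 gT (projT zero)))

  -- since i ≤ g i, n is in the range of g iff g i ≡ n for some i ≤ n
  index : ℕ → ℕ
  index n = search (fun distanceT) (suc n) (n ∷ [])

  P : SubSet
  P n = isZero (index n ∸ n)

  P-computable : ComputableSet P
  P-computable = χ , λ n → sym (bit-isZero (index n ∸ n))
    where
    χ : Total 1
    χ = app2 monusT oneT (app2 monusT (compose (searchT distanceT) (sucT (projT zero) ∷ projT zero ∷ []))
                                      (projT zero))

  P-range : ∀ n → P n ≡ true → g (index n) ≡ n
  P-range n Pn = distance≡0 _ _ (search-found (fun distanceT) (n ∷ []) (suc n)
                                   (s≤s (m∸n≡0⇒m≤n (isZero-true _ Pn))))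

  P-g : ∀ i → P (g i) ≡ true
  P-g i = cong isZero (m≤n⇒m∸n≡0 (≤-trans index≤i (g-≥ i)))
    where
    index≤i : index (g i) ≤ i
    index≤i = search-≤-zero (fun distanceT) (g i ∷ []) (suc (g i)) i (distance-self (g i))

  P⊆R : ∀ n → P n ≡ true → R n
  P⊆R n Pn = subst R (P-range n Pn) (g-in (index n))

  P-infinite : Infinite P
  P-infinite N = g N , g-≥ N , P-g N

  -- of two consecutive numbers at most one is in the range of g
  P-coinfinite : Infinite (λ n → not (P n))
  P-coinfinite N with P N in PN | P (suc N) in P1+N
  ... | false | _     = N , ≤-refl , cong not PN
  ... | true  | false = suc N , n≤1+n N , cong not P1+N
  ... | true  | true  = ⊥-elim (neighbours (index N) (index (suc N)) (P-range N PN) (P-range (suc N) P1+N))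
    where
    neighbours : ∀ i j → g i ≡ N → g j ≡ suc N → ⊥
    neighbours i j gi gj with <-cmp i j
    ... | tri< i<j _ _  = 1+n≰n (subst₂ (λ a b → suc (suc a) ≤ b) gi gj (g-gap i<j))
    ... | tri≈ _ refl _ = 1+n≢n (trans (sym gj) gi)
    ... | tri> _ _ j<i  = 1+n≰n (≤-trans (m≤n+m (suc N) 2)
                                         (subst₂ (λ a b → suc (suc a) ≤ b) gj gi (g-gap j<i)))

-- A computable, infinite and co-infinite set P is mapped onto the even
-- numbers by a computable permutation: the element of P with k smaller
-- elements in P goes to 2k, that of the complement to 2k + 1.

ifZero-bit : ∀ b (x y : ℕ) → ifZero (bit b) x y ≡ (if b then y else x)
ifZero-bit true  x y = refl
ifZero-bit false x y = refl

module ToEvens (P : SubSet) (computable : ComputableSet P)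
               (infinite : Infinite P) (coinfinite : Infinite (λ n → not (P n))) where

  P̄ : SubSet
  P̄ n = not (P n)

  module In  = Enumerate P infinite
  module Out = Enumerate P̄ coinfinite

  π : ℕ → ℕ
  π n = if P n then count P n + count P n else suc (count P̄ n + count P̄ n)

  π⁻¹ : ℕ → ℕ
  π⁻¹ = interleave In.nth Out.nth

  π-in : ∀ n → P n ≡ true → π n ≡ count P n + count P n
  π-in n Pn = cong (λ b → if b then count P n + count P n else suc (count P̄ n + count P̄ n)) Pn

  π-out : ∀ n → P n ≡ false → π n ≡ suc (count P̄ n + count P̄ n)
  π-out n Pn = cong (λ b → if b then count P n + count P n else suc (count P̄ n + count P̄ n)) Pn

  left : ∀ n → π⁻¹ (π n) ≡ n
  left n = byMembership (P n) refl
    where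
    open ≡-Reasoning
    byMembership : ∀ b → P n ≡ b → π⁻¹ (π n) ≡ n
    byMembership true Pn = begin
      π⁻¹ (π n)                         ≡⟨ cong π⁻¹ (π-in n Pn) ⟩
      π⁻¹ (count P n + count P n)       ≡⟨ interleave-even In.nth Out.nth (count P n) ⟩
      In.nth (count P n)                ≡⟨ In.nth-count n Pn ⟩
      n                                 ∎
    byMembership false Pn = begin
      π⁻¹ (π n)                         ≡⟨ cong π⁻¹ (π-out n Pn) ⟩
      π⁻¹ (suc (count P̄ n + count P̄ n)) ≡⟨ interleave-odd In.nth Out.nth (count P̄ n) ⟩
      Out.nth (count P̄ n)               ≡⟨ Out.nth-count n (cong not Pn) ⟩
      n                                 ∎

  right : ∀ m → π (π⁻¹ m) ≡ m
  right m with halves m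
  ... | even i = begin
    π (π⁻¹ (i + i))                            ≡⟨ cong π (interleave-even In.nth Out.nth i) ⟩
    π (In.nth i)                               ≡⟨ π-in (In.nth i) (In.nth-in i) ⟩
    count P (In.nth i) + count P (In.nth i)    ≡⟨ cong₂ _+_ (In.count-nth i) (In.count-nth i) ⟩
    i + i                                      ∎
    where open ≡-Reasoning
  ... | odd i = begin
    π (π⁻¹ (suc (i + i)))                      ≡⟨ cong π (interleave-odd In.nth Out.nth i) ⟩
    π (Out.nth i)                              ≡⟨ π-out (Out.nth i) (not-true (Out.nth-in i)) ⟩
    suc (count P̄ (Out.nth i) + count P̄ (Out.nth i))
                                               ≡⟨ cong suc (cong₂ _+_ (Out.count-nth i) (Out.count-nth i)) ⟩
    suc (i + i)                                ∎
    where
    open ≡-Reasoning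
    not-true : ∀ {b} → not b ≡ true → b ≡ false
    not-true {false} _ = refl

  χ : Total 1
  χ = proj₁ computable

  countT : Total 1
  countT = primRecT zeroT (app2 addT (projT (suc zero)) (app1 χ (projT zero)))

  countT-count : ∀ n → run1 countT n ≡ count P n
  countT-count zero    = refl
  countT-count (suc n) = trans (cong₂ _+_ (countT-count n) (proj₂ computable n)) (sym (count-suc P n))

  πT : Total 1
  πT = withFun raw (λ xs → π (head xs)) agrees
    where
    double : Total 1 → Total 1
    double t = app2 addT t t
    raw : Total 1
    raw = app3 ifZeroT χ (sucT (double (app2 monusT (projT zero) countT))) (double countT)
    agrees : ∀ xs → fun raw xs ≡ π (head xs)
    agrees (n ∷ []) rewrite countT-count n | proj₂ computable n | sym (count-complement P n) =
      ifZero-bit (P n) _ _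

  perm : CompPerm
  perm = record { π = π ; π⁻¹ = π⁻¹ ; π-comp = code πT , (λ n → eval πT (n ∷ []))
                ; left = left ; right = right }

  perm-evens : ∀ i → P (CompPerm.π⁻¹ perm (i + i)) ≡ true
  perm-evens i = subst (λ x → P x ≡ true) (sym (interleave-even In.nth Out.nth i)) (In.nth-in i)

ce-covers-evens : ∀ (c : PR 1) → (∀ N → Σ ℕ λ n → N ≤ n × W c n) →
                  Σ CompPerm λ p → ∀ i → W c (CompPerm.π⁻¹ p (i + i))
ce-covers-evens c infinite = perm , evensInW
  where
  open Selector c infinite
  open SparseRange (W c) selectorT selector-above selector-in
  open ToEvens P P-computable P-infinite P-coinfinite
  evensInW : ∀ i → W c (CompPerm.π⁻¹ perm (i + i))
  evensInW i = P⊆R (CompPerm.π⁻¹ perm (i + i)) (perm-evens i)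

lowerDensityZero⇒immune : ∀ (S : SubSet) → Infinite S → IntrinsicLowerDensityZero S → Immune S
lowerDensityZero⇒immune S infinite sparse =
  infinite , λ c W⊆S infiniteW → evensCovered c W⊆S (ce-covers-evens c infiniteW)
  where
  evensCovered : ∀ c → (∀ n → W c n → S n ≡ true) →
                 (Σ CompPerm λ p → ∀ i → W c (CompPerm.π⁻¹ p (i + i))) → ⊥
  evensCovered c W⊆S (p , evensInW) =
    evens-not-sparse (image p S) (λ i → W⊆S (CompPerm.π⁻¹ p (i + i)) (evensInW i)) (sparse p)

mainTheorem12 : (∀ (S : SubSet) → Infinite S → IntrinsicLowerDensityZero S → Immune S)
    × (∀ (S : SubSet) → Infinite S → IntrinsicDensityZero S → Immune S)
mainTheorem12 =
  lowerDensityZero⇒immune ,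
  λ S infinite dense0 → lowerDensityZero⇒immune S infinite (λ p → density→lowerDensity _ (dense0 p))
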